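{- Any neutral is a value: if $\Gamma\vdash n\Rightarrow A$, then $n$ is a value at type $A$ in context $\Gamma$.
   Context: Simply-typed $\lambda$-calculus with sums (types base, $\top,\times,\to,\bot,+$; usual terms including $\mathrm{raise}$ and $\mathrm{case}\ s\ (x.b_l)\ (x.b_r)$). Reduction $\twoheadrightarrow$: reflexive-transitive closure of the congruence closure of $\beta$-rules and commuting conversions $e[\mathrm{raise}\,t]\to\mathrm{raise}\,t$, $e[\mathrm{case}\ s\ (x.b_l)\ (x.b_r)]\to\mathrm{case}\ s\ (x.e[b_l])\ (x.e[b_r])$ for eliminations $e$ (application to an argument, projection, case). Normal $\Gamma\vdash t\Leftarrow A$ / neutral $\Gamma\vdash t\Rightarrow A$: checking rules for $\star,(t,u),\lambda,\mathrm{inl},\mathrm{inr}$, demotion of inferring terms, $\mathrm{raise}\,t\Leftarrow A$ for $t\Rightarrow\bot$, case on $s\Rightarrow A+B$ with checking branches; inferring rules for constants, variables, projections of inferring products, application $t\,u$ with $t\Rightarrow A\to B$, $u\Leftarrow A$. Covering: $t\in\mathrm{Tm}(\Gamma,A)$ is covered by a context-indexed predicate $F$ if $F(\Gamma,t)$; or $t=\mathrm{raise}\,n$ with $\Gamma\vdash n\Rightarrow\bot$; or $t=\mathrm{case}\ n\ (x.b_l)\ (x.b_r)$ with $\Gamma\vdash n\Rightarrow A_1+A_2$ and $b_l$, $b_r$ covered by $F$ in $\Gamma.(x:A_1)$, $\Gamma.(x:A_2)$ (inductively). Values (by induction on types): raw value at $T$ in $\Gamma$: neutral if $T$ base or $\bot$;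 neutral or $\star$ if $T=\top$; neutral, $\mathrm{inl}\,a$ ($a$ value at $A$) or $\mathrm{inr}\,b$ ($b$ value at $B$) if $T=A+B$. Value at $T$: if $T$ positive (base, $\bot$, $+$), covered by raw values; if $T=\top$, normal; if $T=A_1\times A_2$, normal with each $\pi_iv$ reducible at $A_i$; if $T=A\to B$, normal and for every renaming $\rho\in\mathrm{Ren}(\Delta,\Gamma)$ and value $u$ at $A$ in $\Delta$, $v[\rho]\,u$ reducible at $B$ in $\Delta$. Reducible at $T$: reduces to a value at $T$. -}

module Defs where

open import Data.Nat using (ℕ)
open import Data.Product using (Σ; _×_; _,_)
open import Relation.Binary.Construct.Closure.ReflexiveTransitive using (Star)

infixr 6 _⇒_
infixr 7 _+ᵗ_
infixr 8 _×ᵗ_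

data Ty : Set where
  base  : ℕ → Ty
  ⊤ᵗ    : Ty
  _×ᵗ_  : Ty → Ty → Ty
  _⇒_   : Ty → Ty → Ty
  ⊥ᵗ    : Ty
  _+ᵗ_  : Ty → Ty → Ty

infixl 5 _▸_

data Ctx : Set where
  ∅   : Ctx
  _▸_ : Ctx → Ty → Ctx

data Var : Ctx → Ty → Set where
  here  : ∀ {Γ A} → Var (Γ ▸ A) A
  there : ∀ {Γ A B} → Var Γ A → Var (Γ ▸ B) A

data Tm (Γ : Ctx) : Ty → Set where
  cst   : ∀ A → ℕ → Tm Γ A
  var   : ∀ {A} → Var Γ A → Tm Γ A
  ⋆     : Tm Γ ⊤ᵗ
  pair  : ∀ {A B} → Tm Γ A → Tm Γ B → Tm Γ (A ×ᵗ B)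
  π₁    : ∀ {A B} → Tm Γ (A ×ᵗ B) → Tm Γ A
  π₂    : ∀ {A B} → Tm Γ (A ×ᵗ B) → Tm Γ B
  lam   : ∀ {A B} → Tm (Γ ▸ A) B → Tm Γ (A ⇒ B)
  app   : ∀ {A B} → Tm Γ (A ⇒ B) → Tm Γ A → Tm Γ B
  raise : ∀ {A} → Tm Γ ⊥ᵗ → Tm Γ A
  inl   : ∀ {A B} → Tm Γ A → Tm Γ (A +ᵗ B)
  inr   : ∀ {A B} → Tm Γ B → Tm Γ (A +ᵗ B)
  case  : ∀ {A B C} → Tm Γ (A +ᵗ B) → Tm (Γ ▸ A) C → Tm (Γ ▸ B) C → Tm Γ C

Ren : Ctx → Ctx → Set
Ren Δ Γ = ∀ {A} → Var Γ A → Var Δ A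

liftRen : ∀ {Δ Γ B} → Ren Δ Γ → Ren (Δ ▸ B) (Γ ▸ B)
liftRen ρ here      = here
liftRen ρ (there x) = there (ρ x)

ren : ∀ {Δ Γ A} → Ren Δ Γ → Tm Γ A → Tm Δ A
ren ρ (cst A c)    = cst A c
ren ρ (var x)      = var (ρ x)
ren ρ ⋆            = ⋆
ren ρ (pair t u)   = pair (ren ρ t) (ren ρ u)
ren ρ (π₁ t)       = π₁ (ren ρ t)
ren ρ (π₂ t)       = π₂ (ren ρ t)
ren ρ (lam t)      = lam (ren (liftRen ρ) t)
ren ρ (app t u)    = app (ren ρ t) (ren ρ u)
ren ρ (raise t)    = raise (ren ρ t)
ren ρ (inl t)      = inl (ren ρ t)
ren ρ (inr t)      = inr (ren ρ t)
ren ρ (case s l r) = case (ren ρ s) (ren (liftRen ρ) l) (ren (liftRen ρ) r)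

wk : ∀ {Γ A B} → Tm Γ A → Tm (Γ ▸ B) A
wk = ren there

wk₁ : ∀ {Γ A B C} → Tm (Γ ▸ B) C → Tm (Γ ▸ A ▸ B) C
wk₁ = ren (liftRen there)

Sub : Ctx → Ctx → Set
Sub Δ Γ = ∀ {A} → Var Γ A → Tm Δ A

liftSub : ∀ {Δ Γ B} → Sub Δ Γ → Sub (Δ ▸ B) (Γ ▸ B)
liftSub σ here      = var here
liftSub σ (there x) = wk (σ x)

sub : ∀ {Δ Γ A} → Sub Δ Γ → Tm Γ A → Tm Δ A
sub σ (cst A c)    = cst A c
sub σ (var x)      = σ x
sub σ ⋆            = ⋆
sub σ (pair t u)   = pair (sub σ t) (sub σ u)
sub σ (π₁ t)       = π₁ (sub σ t)
sub σ (π₂ t)       = π₂ (sub σ t)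
sub σ (lam t)      = lam (sub (liftSub σ) t)
sub σ (app t u)    = app (sub σ t) (sub σ u)
sub σ (raise t)    = raise (sub σ t)
sub σ (inl t)      = inl (sub σ t)
sub σ (inr t)      = inr (sub σ t)
sub σ (case s l r) = case (sub σ s) (sub (liftSub σ) l) (sub (liftSub σ) r)

single : ∀ {Γ A} → Tm Γ A → Sub Γ (Γ ▸ A)
single u here      = u
single u (there x) = var x

_[_] : ∀ {Γ A B} → Tm (Γ ▸ A) B → Tm Γ A → Tm Γ B
t [ u ] = sub (single u) t

infix 4 _⟶_

data _⟶_ {Γ : Ctx} : ∀ {A} → Tm Γ A → Tm Γ A → Set where
  β-⇒    : ∀ {A B} {t : Tm (Γ ▸ A) B} {u : Tm Γ A} → app (lam t) u ⟶ t [ u ]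
  β-π₁   : ∀ {A B} {t : Tm Γ A} {u : Tm Γ B} → π₁ (pair t u) ⟶ t
  β-π₂   : ∀ {A B} {t : Tm Γ A} {u : Tm Γ B} → π₂ (pair t u) ⟶ u
  β-inl  : ∀ {A B C} {a : Tm Γ A} {l : Tm (Γ ▸ A) C} {r : Tm (Γ ▸ B) C} →
           case (inl a) l r ⟶ l [ a ]
  β-inr  : ∀ {A B C} {b : Tm Γ B} {l : Tm (Γ ▸ A) C} {r : Tm (Γ ▸ B) C} →
           case (inr b) l r ⟶ r [ b ]
  cc-raise-app  : ∀ {A B} {t : Tm Γ ⊥ᵗ} {u : Tm Γ A} →
                  app {A = A} {B = B} (raise t) u ⟶ raise t
  cc-raise-π₁   : ∀ {A B} {t : Tm Γ ⊥ᵗ} → π₁ {A = A} {B = B} (raise t) ⟶ raise t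
  cc-raise-π₂   : ∀ {A B} {t : Tm Γ ⊥ᵗ} → π₂ {A = A} {B = B} (raise t) ⟶ raise t
  cc-raise-case : ∀ {A B C} {t : Tm Γ ⊥ᵗ} {l : Tm (Γ ▸ A) C} {r : Tm (Γ ▸ B) C} →
                  case (raise t) l r ⟶ raise t
  cc-case-app   : ∀ {A B C D} {s : Tm Γ (A +ᵗ B)} {l : Tm (Γ ▸ A) (C ⇒ D)}
                    {r : Tm (Γ ▸ B) (C ⇒ D)} {u : Tm Γ C} →
                  app (case s l r) u ⟶ case s (app l (wk u)) (app r (wk u))
  cc-case-π₁    : ∀ {A B C D} {s : Tm Γ (A +ᵗ B)} {l : Tm (Γ ▸ A) (C ×ᵗ D)}
                    {r : Tm (Γ ▸ B) (C ×ᵗ D)} →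
                  π₁ (case s l r) ⟶ case s (π₁ l) (π₁ r)
  cc-case-π₂    : ∀ {A B C D} {s : Tm Γ (A +ᵗ B)} {l : Tm (Γ ▸ A) (C ×ᵗ D)}
                    {r : Tm (Γ ▸ B) (C ×ᵗ D)} →
                  π₂ (case s l r) ⟶ case s (π₂ l) (π₂ r)
  cc-case-case  : ∀ {A B C D E} {s : Tm Γ (A +ᵗ B)} {l : Tm (Γ ▸ A) (C +ᵗ D)}
                    {r : Tm (Γ ▸ B) (C +ᵗ D)} {l′ : Tm (Γ ▸ C) E} {r′ : Tm (Γ ▸ D) E} →
                  case (case s l r) l′ r′ ⟶
                    case s (case l (wk₁ l′) (wk₁ r′)) (case r (wk₁ l′) (wk₁ r′))
  ξ-pairˡ : ∀ {A B} {t t′ : Tm Γ A} {u : Tm Γ B} → t ⟶ t′ → pair t u ⟶ pair t′ u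
  ξ-pairʳ : ∀ {A B} {t : Tm Γ A} {u u′ : Tm Γ B} → u ⟶ u′ → pair t u ⟶ pair t u′
  ξ-π₁    : ∀ {A B} {t t′ : Tm Γ (A ×ᵗ B)} → t ⟶ t′ → π₁ t ⟶ π₁ t′
  ξ-π₂    : ∀ {A B} {t t′ : Tm Γ (A ×ᵗ B)} → t ⟶ t′ → π₂ t ⟶ π₂ t′
  ξ-lam   : ∀ {A B} {t t′ : Tm (Γ ▸ A) B} → t ⟶ t′ → lam t ⟶ lam t′
  ξ-appˡ  : ∀ {A B} {t t′ : Tm Γ (A ⇒ B)} {u : Tm Γ A} → t ⟶ t′ → app t u ⟶ app t′ u
  ξ-appʳ  : ∀ {A B} {t : Tm Γ (A ⇒ B)} {u u′ : Tm Γ A} → u ⟶ u′ → app t u ⟶ app t u′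
  ξ-raise : ∀ {A} {t t′ : Tm Γ ⊥ᵗ} → t ⟶ t′ → raise {A = A} t ⟶ raise t′
  ξ-inl   : ∀ {A B} {t t′ : Tm Γ A} → t ⟶ t′ → inl {B = B} t ⟶ inl t′
  ξ-inr   : ∀ {A B} {t t′ : Tm Γ B} → t ⟶ t′ → inr {A = A} t ⟶ inr t′
  ξ-caseˢ : ∀ {A B C} {s s′ : Tm Γ (A +ᵗ B)} {l : Tm (Γ ▸ A) C} {r : Tm (Γ ▸ B) C} →
            s ⟶ s′ → case s l r ⟶ case s′ l r
  ξ-caseˡ : ∀ {A B C} {s : Tm Γ (A +ᵗ B)} {l l′ : Tm (Γ ▸ A) C} {r : Tm (Γ ▸ B) C} →
            l ⟶ l′ → case s l r ⟶ case s l′ r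
  ξ-caseʳ : ∀ {A B C} {s : Tm Γ (A +ᵗ B)} {l : Tm (Γ ▸ A) C} {r r′ : Tm (Γ ▸ B) C} →
            r ⟶ r′ → case s l r ⟶ case s l r′

infix 4 _↠_
_↠_ : ∀ {Γ A} → Tm Γ A → Tm Γ A → Set
_↠_ = Star _⟶_

-- Normal (checking, Γ ⊢ t ⇐ A) and neutral (inferring, Γ ⊢ t ⇒ A) terms

data Nf {Γ : Ctx} : ∀ {A} → Tm Γ A → Set
data Ne {Γ : Ctx} : ∀ {A} → Tm Γ A → Set

data Nf {Γ} where
  ⋆    : Nf ⋆
  pair : ∀ {A B} {t : Tm Γ A} {u : Tm Γ B} → Nf t → Nf u → Nf (pair t u)
  lam  : ∀ {A B} {t : Tm (Γ ▸ A) B} → Nf t → Nf (lam t)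
  inl  : ∀ {A B} {t : Tm Γ A} → Nf t → Nf (inl {B = B} t)
  inr  : ∀ {A B} {t : Tm Γ B} → Nf t → Nf (inr {A = A} t)
  ne   : ∀ {A} {t : Tm Γ A} → Ne t → Nf t
  raise : ∀ {A} {t : Tm Γ ⊥ᵗ} → Ne t → Nf (raise {A = A} t)
  case : ∀ {A B C} {s : Tm Γ (A +ᵗ B)} {l : Tm (Γ ▸ A) C} {r : Tm (Γ ▸ B) C} →
         Ne s → Nf l → Nf r → Nf (case s l r)

data Ne {Γ} where
  cst : ∀ {A c} → Ne (cst A c)
  var : ∀ {A} {x : Var Γ A} → Ne (var x)
  π₁  : ∀ {A B} {t : Tm Γ (A ×ᵗ B)} → Ne t → Ne (π₁ t)
  π₂  : ∀ {A B} {t : Tm Γ (A ×ᵗ B)} → Ne t → Ne (π₂ t)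
  app : ∀ {A B} {t : Tm Γ (A ⇒ B)} {u : Tm Γ A} → Ne t → Nf u → Ne (app t u)

data Covered {A : Ty} (F : (Γ : Ctx) → Tm Γ A → Set) : (Γ : Ctx) → Tm Γ A → Set where
  leaf  : ∀ {Γ t} → F Γ t → Covered F Γ t
  raise : ∀ {Γ} {n : Tm Γ ⊥ᵗ} → Ne n → Covered F Γ (raise n)
  case  : ∀ {Γ A₁ A₂} {n : Tm Γ (A₁ +ᵗ A₂)} {bl : Tm (Γ ▸ A₁) A} {br : Tm (Γ ▸ A₂) A} →
          Ne n → Covered F (Γ ▸ A₁) bl → Covered F (Γ ▸ A₂) br →
          Covered F Γ (case n bl br)

data RawSum (A B : Ty) (VA : (Γ : Ctx) → Tm Γ A → Set) (VB : (Γ : Ctx) → Tm Γ B → Set)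
            (Γ : Ctx) : Tm Γ (A +ᵗ B) → Set where
  ne  : ∀ {t} → Ne t → RawSum A B VA VB Γ t
  inl : ∀ {a} → VA Γ a → RawSum A B VA VB Γ (inl a)
  inr : ∀ {b} → VB Γ b → RawSum A B VA VB Γ (inr b)

data RawUnit (Γ : Ctx) : Tm Γ ⊤ᵗ → Set where
  ne : ∀ {t} → Ne t → RawUnit Γ t
  ⋆  : RawUnit Γ ⋆

RawValue : (T : Ty) → (Γ : Ctx) → Tm Γ T → Set
Value    : (T : Ty) → (Γ : Ctx) → Tm Γ T → Set
Reducible : (T : Ty) → (Γ : Ctx) → Tm Γ T → Set

RawValue (base i)   Γ t = Ne t
RawValue ⊥ᵗ         Γ t = Ne t
RawValue ⊤ᵗ         Γ t = RawUnit Γ t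
RawValue (A +ᵗ B)   Γ t = RawSum A B (Value A) (Value B) Γ t
RawValue (A ×ᵗ B)   Γ t = Ne t
RawValue (A ⇒ B)    Γ t = Ne t

Value (base i) Γ t = Covered (RawValue (base i)) Γ t
Value ⊥ᵗ       Γ t = Covered (RawValue ⊥ᵗ) Γ t
Value (A +ᵗ B) Γ t = Covered (RawValue (A +ᵗ B)) Γ t
Value ⊤ᵗ       Γ t = Nf t
Value (A ×ᵗ B) Γ t = Nf t × Reducible A Γ (π₁ t) × Reducible B Γ (π₂ t)
Value (A ⇒ B)  Γ t = Nf t × (∀ (Δ : Ctx) (ρ : Ren Δ Γ) (u : Tm Δ A) →
                              Value A Δ u → Reducible B Δ (app (ren ρ t) u))

Reducible T Γ t = Σ (Tm Γ T) (λ v → (t ↠ v) × Value T Γ v)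

module Submission where

-- Reflection and reification by mutual induction on types: a neutral at a
-- product is a value because its projections are again neutral, and a
-- neutral n at A ⇒ B is one because n[ρ] u is neutral for any value u at A,
-- once u is reified to a normal form and renaming is known to preserve
-- neutrality.

open import Defs
open import Data.Product using (_,_; proj₁)
open import Relation.Binary.Construct.Closure.ReflexiveTransitive using (ε)

ren-Ne : ∀ {Δ Γ A} (ρ : Ren Δ Γ) {t : Tm Γ A} → Ne t → Ne (ren ρ t)
ren-Nf : ∀ {Δ Γ A} (ρ : Ren Δ Γ) {t : Tm Γ A} → Nf t → Nf (ren ρ t)

ren-Ne ρ cst       = cst
ren-Ne ρ var       = var
ren-Ne ρ (π₁ n)    = π₁ (ren-Ne ρ n)
ren-Ne ρ (π₂ n)    = π₂ (ren-Ne ρ n)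
ren-Ne ρ (app n u) = app (ren-Ne ρ n) (ren-Nf ρ u)

ren-Nf ρ ⋆            = ⋆
ren-Nf ρ (pair t u)   = pair (ren-Nf ρ t) (ren-Nf ρ u)
ren-Nf ρ (lam t)      = lam (ren-Nf (liftRen ρ) t)
ren-Nf ρ (inl t)      = inl (ren-Nf ρ t)
ren-Nf ρ (inr t)      = inr (ren-Nf ρ t)
ren-Nf ρ (ne n)       = ne (ren-Ne ρ n)
ren-Nf ρ (raise n)    = raise (ren-Ne ρ n)
ren-Nf ρ (case s l r) = case (ren-Ne ρ s) (ren-Nf (liftRen ρ) l) (ren-Nf (liftRen ρ) r)

Covered⇒Nf : ∀ {A} {F : (Γ : Ctx) → Tm Γ A → Set} →
             (∀ {Γ t} → F Γ t → Nf t) → ∀ {Γ t} → Covered F Γ t → Nf t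
Covered⇒Nf F⇒Nf (leaf f)     = F⇒Nf f
Covered⇒Nf F⇒Nf (raise n)    = raise n
Covered⇒Nf F⇒Nf (case n l r) = case n (Covered⇒Nf F⇒Nf l) (Covered⇒Nf F⇒Nf r)

reify       : ∀ A {Γ} {t : Tm Γ A} → Value A Γ t → Nf t
RawSum⇒Nf : ∀ A B {Γ} {t : Tm Γ (A +ᵗ B)} → RawValue (A +ᵗ B) Γ t → Nf t

RawSum⇒Nf A B (ne n)  = ne n
RawSum⇒Nf A B (inl v) = inl (reify A v)
RawSum⇒Nf A B (inr v) = inr (reify B v)

reify (base i) v = Covered⇒Nf ne v
reify ⊥ᵗ       v = Covered⇒Nf ne v
reify (A +ᵗ B) v = Covered⇒Nf (RawSum⇒Nf A B) v
reify ⊤ᵗ       v = v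
reify (A ×ᵗ B) v = proj₁ v
reify (A ⇒ B)  v = proj₁ v

reflect : ∀ A {Γ} {t : Tm Γ A} → Ne t → Value A Γ t
reflect (base i) n = leaf n
reflect ⊥ᵗ       n = leaf n
reflect (A +ᵗ B) n = leaf (ne n)
reflect ⊤ᵗ       n = ne n
reflect (A ×ᵗ B) n = ne n , (_ , ε , reflect A (π₁ n)) , (_ , ε , reflect B (π₂ n))
reflect (A ⇒ B)  n = ne n , λ Δ ρ u v → _ , ε , reflect B (app (ren-Ne ρ n) (reify A v))

mainTheorem10 : (Γ : Ctx) (A : Ty) (n : Tm Γ A) → Ne n → Value A Γ n
mainTheorem10 Γ A n = reflect A
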